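{- Let $n \geq 1$ and let $L = (a_0, a_1, \ldots, a_n)$ be a \textsc{Rotisserie Nim} position such that $(a_1, \ldots, a_n) \in \mathcal{N}$. Then: (i) if $n+1$ is odd and $L \in \mathcal{N}$, then $(a_1, \ldots, a_n, 1) \in \mathcal{P}$; (ii) if $n+1$ is even and $L \in \mathcal{N}$, then $(a_1, \ldots, a_n, a_0 - 1) \in \mathcal{P}$.
   Context: \textsc{Rotisserie Nim} is an impartial combinatorial game played under normal play (a player unable to move loses). A position is a finite list $L = (a_0, a_1, \ldots, a_n)$ of positive integers (a queue of heaps, $a_0$ at the front); the empty list is terminal. The options of $L$ are $(a_1, \ldots, a_n)$ and $(a_1, \ldots, a_n, b)$ for every integer $b$ with $1 \leq b < a_0$. $\mathcal{N}$ denotes the positions from which the next player to move wins, $\mathcal{P}$ those from which the previous player wins. -}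

module Defs where

open import Data.Nat using (ℕ; suc; _<_; _≤_; _%_)
open import Data.List using (List; []; _∷_; _++_; [_])
open import Relation.Binary.PropositionalEquality using (_≡_)

-- A Rotisserie Nim position is a list of heap sizes (front first);
-- positivity of all heaps is imposed separately as a hypothesis.

data Option : List ℕ → List ℕ → Set where
  drop-front : ∀ a as → Option (a ∷ as) as
  rotate     : ∀ a as b → 1 ≤ b → b < a → Option (a ∷ as) (as ++ [ b ])

-- Outcome classes under normal play (game is finite: the heap sum strictly
-- decreases with each move, so the inductive definitions are the outcome classes).
data IsP : List ℕ → Set
data IsN : List ℕ → Set

data IsP where
  allN : ∀ {L} → (∀ L' → Option L L' → IsN L') → IsP L

data IsN where
  someP : ∀ {L} L' → Option L L' → IsP L' → IsN L

Odd : ℕ → Set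
Odd n = n % 2 ≡ 1

Even : ℕ → Set
Even n = n % 2 ≡ 0

-- A heap at index k of the queue reaches the front after exactly k moves, and a larger
-- front heap only adds options. Hence enlarging a heap at an even index can only help
-- the player to move, and enlarging one at an odd index can only hurt them. If L ∈ 𝒩
-- while (a₁, …, aₙ) ∈ 𝒩, the winning move from L must be a rotation to some
-- (a₁, …, aₙ, b) ∈ 𝒫 with 1 ≤ b ≤ a₀ − 1; the new heap sits at index n, so moving b to 1
-- (n even) or to a₀ − 1 (n odd) keeps the position in 𝒫.
module Submission where

open import Defs
open import Data.Nat using (ℕ; zero; suc; _≤_; _<_; _∸_)
open import Data.Nat.Properties using (≤-trans; suc[m]≤n⇒m≤pred[n])
open import Data.List using (List; []; _∷_; _++_; [_]; length)
open import Data.List.Properties using (++-assoc)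
open import Data.List.Relation.Unary.All using (All)
open import Data.Product using (Σ; ∃; _×_; _,_)
open import Data.Empty using (⊥; ⊥-elim)
open import Relation.Binary.PropositionalEquality using (refl; sym; subst₂)

IsN⇒¬IsP : ∀ {L} → IsN L → IsP L → ⊥
IsN⇒¬IsP (someP L' o p) (allN f) = IsN⇒¬IsP (f L' o) p

record _≼_ (A B : List ℕ) : Set where
  field
    N-mono     : IsN A → IsN B
    P-antimono : IsP B → IsP A

open _≼_

≼-refl : ∀ {A} → A ≼ A
≼-refl = record { N-mono = λ n → n ; P-antimono = λ p → p }

≼-by-simulation : ∀ {A B} →
  (∀ {A'} → Option A A' → Σ (List ℕ) λ B' → Option B B' × B' ≼ A') → A ≼ B
≼-by-simulation {A} {B} sim = record { N-mono = N-mono′ ; P-antimono = P-antimono′ }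
  where
  N-mono′ : IsN A → IsN B
  N-mono′ (someP A' o p) with sim o
  ... | B' , o′ , B'≼A' = someP B' o′ (P-antimono B'≼A' p)

  P-antimono′ : IsP B → IsP A
  P-antimono′ (allN f) = allN λ A' o → let (B' , o′ , B'≼A') = sim o in N-mono B'≼A' (f B' o′)

≼-front : ∀ {u v} ys → u ≤ v → (u ∷ ys) ≼ (v ∷ ys)
≼-front {v = v} ys u≤v = ≼-by-simulation λ
  { (drop-front _ _)         → ys , drop-front v ys , ≼-refl
  ; (rotate _ _ b 1≤b b<u) → ys ++ [ b ] , rotate v ys b 1≤b (≤-trans b<u u≤v) , ≼-refl }

_≤[_]_ : ℕ → ℕ → ℕ → Set
u ≤[ zero ] v  = u ≤ v
u ≤[ suc k ] v = v ≤[ k ] u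

≼-at : ∀ xs {u v} → u ≤[ length xs ] v → ∀ ys → (xs ++ u ∷ ys) ≼ (xs ++ v ∷ ys)
≼-at []       u≤v ys = ≼-front ys u≤v
≼-at (x ∷ xs) {u} {v} v≤u ys = ≼-by-simulation λ
  { (drop-front _ _)         → xs ++ v ∷ ys , drop-front x _ , ≼-at xs v≤u ys
  ; (rotate _ _ b 1≤b b<x) → (xs ++ v ∷ ys) ++ [ b ] , rotate x _ b 1≤b b<x , ≼-at-snoc b }
  where
  ≼-at-snoc : ∀ b → ((xs ++ v ∷ ys) ++ [ b ]) ≼ ((xs ++ u ∷ ys) ++ [ b ])
  ≼-at-snoc b = subst₂ _≼_ (sym (++-assoc xs (v ∷ ys) [ b ])) (sym (++-assoc xs (u ∷ ys) [ b ]))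
                       (≼-at xs v≤u (ys ++ [ b ]))

≤⇒≤[even] : ∀ k {u v} → Even k → u ≤ v → u ≤[ k ] v
≥⇒≤[odd]  : ∀ k {u v} → Odd k → v ≤ u → u ≤[ k ] v
≤⇒≤[even] zero          _    u≤v = u≤v
≤⇒≤[even] (suc zero)    ()
≤⇒≤[even] (suc (suc k)) even u≤v = ≤⇒≤[even] k even u≤v
≥⇒≤[odd]  zero          ()
≥⇒≤[odd]  (suc zero)    _    v≤u = v≤u
≥⇒≤[odd]  (suc (suc k)) odd  v≤u = ≥⇒≤[odd] k odd v≤u

Odd-suc⇒Even : ∀ n → Odd (suc n) → Even n
Even-suc⇒Odd : ∀ n → Even (suc n) → Odd n
Odd-suc⇒Even zero          _    = refl
Odd-suc⇒Even (suc zero)    ()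
Odd-suc⇒Even (suc (suc n)) odd = Odd-suc⇒Even n odd
Even-suc⇒Odd zero          ()
Even-suc⇒Odd (suc zero)    _    = refl
Even-suc⇒Odd (suc (suc n)) even = Even-suc⇒Odd n even

winning-rotation : ∀ a as → IsN as → IsN (a ∷ as) →
  ∃ λ b → 1 ≤ b × b < a × IsP (as ++ [ b ])
winning-rotation a as N-as (someP _ (drop-front _ _) P-as)        = ⊥-elim (IsN⇒¬IsP N-as P-as)
winning-rotation a as N-as (someP _ (rotate _ _ b 1≤b b<a) P-asb) = b , 1≤b , b<a , P-asb

mainTheorem7 : (a₀ : ℕ) (as : List ℕ) →
    1 ≤ length as →
    All (1 ≤_) (a₀ ∷ as) →
    IsN as →
    (Odd (suc (length as)) → IsN (a₀ ∷ as) → IsP (as ++ [ 1 ])) ×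
    (Even (suc (length as)) → IsN (a₀ ∷ as) → IsP (as ++ [ a₀ ∸ 1 ]))
mainTheorem7 a₀ as _ _ N-as = odd-case , even-case
  where
  n : ℕ
  n = length as

  odd-case : Odd (suc n) → IsN (a₀ ∷ as) → IsP (as ++ [ 1 ])
  odd-case odd N-L with winning-rotation a₀ as N-as N-L
  ... | b , 1≤b , _ , P-asb =
    P-antimono (≼-at as (≤⇒≤[even] n (Odd-suc⇒Even n odd) 1≤b) []) P-asb

  even-case : Even (suc n) → IsN (a₀ ∷ as) → IsP (as ++ [ a₀ ∸ 1 ])
  even-case even N-L with winning-rotation a₀ as N-as N-L
  ... | b , _ , b<a₀ , P-asb =
    P-antimono (≼-at as (≥⇒≤[odd] n (Even-suc⇒Odd n even) (suc[m]≤n⇒m≤pred[n] b<a₀)) []) P-asb
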